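{- Let $\mathbf{A}=(\mathsf{A},\wedge,\vee,\top,\bot,\rightarrow,\leftarrow,\cdot)$ be a residuated basic algebra. Then its reduct $(\mathsf{A},\wedge,\vee,\top,\bot,\rightarrow)$ is a basic algebra.
   Context: A residuated basic algebra is an algebra $\mathbf{A}=(\mathsf{A},\wedge,\vee,\top,\bot,\rightarrow,\leftarrow,\cdot)$ such that $(\mathsf{A},\wedge,\vee,\top,\bot)$ is a bounded distributive lattice with lattice order $\leq$, and $\cdot,\rightarrow,\leftarrow$ are binary operations on $\mathsf{A}$ satisfying the residuation law: for all $a,b,c$, $a\cdot b\leq c$ iff $b\leq a\rightarrow c$ iff $a\leq c\leftarrow b$ ($\cdot$ not assumed associative), together with $a\cdot\top\leq a$, $\top\cdot a\leq a$, and $a\cdot b\leq (a\cdot b)\cdot b$ for all $a,b$. A basic algebra is an algebra $(\mathsf{A},\wedge,\vee,\top,\bot,\rightarrow)$ such that $(\mathsf{A},\wedge,\vee,\top,\bot)$ is a bounded distributive lattice with order $\leq$ and $\rightarrow$ is a binary operation satisfying for all $a,b,c$: (1) $a\rightarrow(b\wedge c)=(a\rightarrow b)\wedge(a\rightarrow c)$; (2) $(b\vee c)\rightarrow a=(b\rightarrow a)\wedge(c\rightarrow a)$; (3) $a\rightarrow a=\top$; (4) $a\leq\top\rightarrow a$; (5) $(a\rightarrow b)\wedge(b\rightarrow c)\leq a\rightarrow c$. -}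

module Defs where

open import Level using (Level; _⊔_; suc)
open import Algebra.Core using (Op₂)
open import Relation.Binary.Core using (Rel)
open import Relation.Binary.Lattice.Structures using (IsDistributiveLattice)
open import Relation.Binary.Definitions using (Maximum; Minimum)
open import Function.Bundles using (_⇔_)

record IsBoundedDistributiveLattice {a ℓ₁ ℓ₂} {A : Set a}
    (_≈_ : Rel A ℓ₁) (_≤_ : Rel A ℓ₂)
    (_∧_ _∨_ : Op₂ A) (⊤ ⊥ : A) : Set (a ⊔ ℓ₁ ⊔ ℓ₂) where
  field
    isDistributiveLattice : IsDistributiveLattice _≈_ _≤_ _∨_ _∧_
    maximum : Maximum _≤_ ⊤
    minimum : Minimum _≤_ ⊥

-- Residuated basic algebra (A, ∧, ∨, ⊤, ⊥, →, ←, ·).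
-- Convention: _⇒_ is →, _⇐_ is ←, _·_ is the (non-associative) product.
record IsResiduatedBasicAlgebra {a ℓ₁ ℓ₂} {A : Set a}
    (_≈_ : Rel A ℓ₁) (_≤_ : Rel A ℓ₂)
    (_∧_ _∨_ : Op₂ A) (⊤ ⊥ : A) (_⇒_ _⇐_ _·_ : Op₂ A) : Set (a ⊔ ℓ₁ ⊔ ℓ₂) where
  field
    isBoundedDistributiveLattice : IsBoundedDistributiveLattice _≈_ _≤_ _∧_ _∨_ ⊤ ⊥
    residuation-⇒ : ∀ x y z → ((x · y) ≤ z) ⇔ (y ≤ (x ⇒ z))
    residuation-⇐ : ∀ x y z → ((x · y) ≤ z) ⇔ (x ≤ (z ⇐ y))
    ·-⊤ʳ : ∀ x → (x · ⊤) ≤ x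
    ·-⊤ˡ : ∀ x → (⊤ · x) ≤ x
    ·-square : ∀ x y → (x · y) ≤ ((x · y) · y)

record IsBasicAlgebra {a ℓ₁ ℓ₂} {A : Set a}
    (_≈_ : Rel A ℓ₁) (_≤_ : Rel A ℓ₂)
    (_∧_ _∨_ : Op₂ A) (⊤ ⊥ : A) (_⇒_ : Op₂ A) : Set (a ⊔ ℓ₁ ⊔ ℓ₂) where
  field
    isBoundedDistributiveLattice : IsBoundedDistributiveLattice _≈_ _≤_ _∧_ _∨_ ⊤ ⊥
    ⇒-∧ : ∀ x y z → (x ⇒ (y ∧ z)) ≈ ((x ⇒ y) ∧ (x ⇒ z))
    ∨-⇒ : ∀ x y z → ((y ∨ z) ⇒ x) ≈ ((y ⇒ x) ∧ (z ⇒ x))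
    ⇒-refl : ∀ x → (x ⇒ x) ≈ ⊤
    ⊤-⇒ : ∀ x → x ≤ (⊤ ⇒ x)
    ⇒-trans : ∀ x y z → ((x ⇒ y) ∧ (y ⇒ z)) ≤ (x ⇒ z)

module Submission where

open import Defs
open import Algebra.Core using (Op₂)
open import Relation.Binary.Core using (Rel)
open import Relation.Binary.PropositionalEquality using (_≡_)
open import Relation.Binary.Lattice.Structures using (IsDistributiveLattice; IsLattice)
open import Function.Bundles using (Equivalence)

-- Every axiom of a basic algebra is a residuation argument; the only
-- non-lattice input is ·-⊤ʳ for x ⇒ x ≈ ⊤, ·-⊤ˡ for x ≤ ⊤ ⇒ x, and the
-- square law x · w ≤ (x · w) · w for transitivity, which lets the single
-- element w = (x ⇒ y) ∧ (y ⇒ z) be used twice in x · w ≤ y · w ≤ z.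

module ResiduatedBasicAlgebraProperties
    {a ℓ₁ ℓ₂} {A : Set a} {_≈_ : Rel A ℓ₁} {_≤_ : Rel A ℓ₂}
    {_∧_ _∨_ : Op₂ A} {⊤ ⊥ : A} {_⇒_ _⇐_ _·_ : Op₂ A}
    (R : IsResiduatedBasicAlgebra _≈_ _≤_ _∧_ _∨_ ⊤ ⊥ _⇒_ _⇐_ _·_)
  where

  open IsResiduatedBasicAlgebra R
  open IsBoundedDistributiveLattice isBoundedDistributiveLattice
    using (isDistributiveLattice; maximum)
  open IsLattice (IsDistributiveLattice.isLattice isDistributiveLattice)

  residuate-⇒ : ∀ {x y z} → (x · y) ≤ z → y ≤ (x ⇒ z)
  residuate-⇒ = Equivalence.to (residuation-⇒ _ _ _)

  unresiduate-⇒ : ∀ {x y z} → y ≤ (x ⇒ z) → (x · y) ≤ z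
  unresiduate-⇒ = Equivalence.from (residuation-⇒ _ _ _)

  residuate-⇐ : ∀ {x y z} → (x · y) ≤ z → x ≤ (z ⇐ y)
  residuate-⇐ = Equivalence.to (residuation-⇐ _ _ _)

  unresiduate-⇐ : ∀ {x y z} → x ≤ (z ⇐ y) → (x · y) ≤ z
  unresiduate-⇐ = Equivalence.from (residuation-⇐ _ _ _)

  ·-⇒-modusPonens : ∀ x y → (x · (x ⇒ y)) ≤ y
  ·-⇒-modusPonens x y = unresiduate-⇒ refl

  ·-monoˡ-≤ : ∀ {x x′} y → x ≤ x′ → (x · y) ≤ (x′ · y)
  ·-monoˡ-≤ y x≤x′ = unresiduate-⇐ (trans x≤x′ (residuate-⇐ refl))

  ⇒-monoʳ-≤ : ∀ x {y y′} → y ≤ y′ → (x ⇒ y) ≤ (x ⇒ y′)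
  ⇒-monoʳ-≤ x y≤y′ = residuate-⇒ (trans (·-⇒-modusPonens x _) y≤y′)

  ⇒-antiˡ-≤ : ∀ {x x′} z → x ≤ x′ → (x′ ⇒ z) ≤ (x ⇒ z)
  ⇒-antiˡ-≤ z x≤x′ = residuate-⇒ (trans (·-monoˡ-≤ _ x≤x′) (·-⇒-modusPonens _ z))

  ⇒-distribˡ-∧ : ∀ x y z → (x ⇒ (y ∧ z)) ≈ ((x ⇒ y) ∧ (x ⇒ z))
  ⇒-distribˡ-∧ x y z = antisym
    (∧-greatest (⇒-monoʳ-≤ x (x∧y≤x y z)) (⇒-monoʳ-≤ x (x∧y≤y y z)))
    (residuate-⇒ (∧-greatest (unresiduate-⇒ (x∧y≤x _ _)) (unresiduate-⇒ (x∧y≤y _ _))))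

  -- Joins in the left argument of · are handled through the other residual ⇐.
  ⇒-antidistribʳ-∨ : ∀ x y z → ((y ∨ z) ⇒ x) ≈ ((y ⇒ x) ∧ (z ⇒ x))
  ⇒-antidistribʳ-∨ x y z = antisym
    (∧-greatest (⇒-antiˡ-≤ x (x≤x∨y y z)) (⇒-antiˡ-≤ x (y≤x∨y y z)))
    (residuate-⇒ (unresiduate-⇐ (∨-least
      (residuate-⇐ (unresiduate-⇒ (x∧y≤x _ _)))
      (residuate-⇐ (unresiduate-⇒ (x∧y≤y _ _))))))

  ⇒-refl : ∀ x → (x ⇒ x) ≈ ⊤
  ⇒-refl x = antisym (maximum _) (residuate-⇒ (·-⊤ʳ x))

  x≤⊤⇒x : ∀ x → x ≤ (⊤ ⇒ x)
  x≤⊤⇒x x = residuate-⇒ (·-⊤ˡ x)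

  ⇒-trans : ∀ x y z → ((x ⇒ y) ∧ (y ⇒ z)) ≤ (x ⇒ z)
  ⇒-trans x y z = residuate-⇒ (trans (·-square x w)
    (trans (·-monoˡ-≤ w (unresiduate-⇒ (x∧y≤x _ _))) (unresiduate-⇒ (x∧y≤y _ _))))
    where w = (x ⇒ y) ∧ (y ⇒ z)

  isBasicAlgebra : IsBasicAlgebra _≈_ _≤_ _∧_ _∨_ ⊤ ⊥ _⇒_
  isBasicAlgebra = record
    { isBoundedDistributiveLattice = isBoundedDistributiveLattice
    ; ⇒-∧ = ⇒-distribˡ-∧
    ; ∨-⇒ = ⇒-antidistribʳ-∨
    ; ⇒-refl = ⇒-refl
    ; ⊤-⇒ = x≤⊤⇒x
    ; ⇒-trans = ⇒-trans
    }

theorem2 : ∀ {a ℓ} {A : Set a} (_≤_ : Rel A ℓ)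
    (_∧_ _∨_ : Op₂ A) (⊤ ⊥ : A) (_⇒_ _⇐_ _·_ : Op₂ A) →
    IsResiduatedBasicAlgebra _≡_ _≤_ _∧_ _∨_ ⊤ ⊥ _⇒_ _⇐_ _·_ →
    IsBasicAlgebra _≡_ _≤_ _∧_ _∨_ ⊤ ⊥ _⇒_
theorem2 _ _ _ _ _ _ _ _ R = ResiduatedBasicAlgebraProperties.isBasicAlgebra R
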